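{- Let $G$ be a finite simple graph. If $G$ has no open twins then $\gamma^{\rm L}(G)\le\gamma^{\rm O}(G)$; if $G$ has no closed twins then $\gamma^{\rm L}(G)\le\gamma^{\rm I}(G)$; and if $G$ has neither open nor closed twins then $\gamma^{\rm O}(G)\le\gamma^{\rm F}(G)$ and $\gamma^{\rm I}(G)\le\gamma^{\rm F}(G)$.
   Context: For a graph $G=(V,E)$, $N(v)$ denotes the open and $N[v]=N(v)\cup\{v\}$ the closed neighborhood of $v$. Open twins are two non-adjacent vertices $u,v$ with $N(u)=N(v)$; closed twins are two adjacent vertices with $N[u]=N[v]$. A set $C\subseteq V$ is: a locating set (L-set) if the sets $N(v)\cap C$, $v\in V\setminus C$, are pairwise distinct; an open-separating set (O-set) if the sets $N(v)\cap C$, $v\in V$, are pairwise distinct; a closed-separating set (I-set) if the sets $N[v]\cap C$, $v\in V$, are pairwise distinct; a full-separating set (F-set) if both an O-set and an I-set. $\gamma^{\rm S}(G)$ is the minimum cardinality of an S-set of $G$. -}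

module Defs where

open import Data.Nat using (ℕ; _≤_)
open import Data.Bool using (Bool; true; false)
open import Data.Fin using (Fin)
open import Data.Fin.Subset using (Subset; _∩_; _∪_; ⁅_⁆; _∉_; ∣_∣)
open import Data.Vec using (tabulate)
open import Data.Product using (Σ; _×_)
open import Relation.Binary.PropositionalEquality using (_≡_; _≢_)

record Graph (n : ℕ) : Set where
  field
    adj    : Fin n → Fin n → Bool
    sym    : ∀ u v → adj u v ≡ adj v u
    irrefl : ∀ v → adj v v ≡ false
open Graph public

module _ {n : ℕ} (G : Graph n) where
  N : Fin n → Subset n
  N v = tabulate (adj G v)

  N[_] : Fin n → Subset n
  N[ v ] = N v ∪ ⁅ v ⁆

  HasOpenTwins : Set
  HasOpenTwins = Σ (Fin n) λ u → Σ (Fin n) λ v →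
    u ≢ v × adj G u v ≡ false × N u ≡ N v

  HasClosedTwins : Set
  HasClosedTwins = Σ (Fin n) λ u → Σ (Fin n) λ v →
    u ≢ v × adj G u v ≡ true × N[ u ] ≡ N[ v ]

  IsLSet : Subset n → Set
  IsLSet C = ∀ u v → u ∉ C → v ∉ C → u ≢ v → N u ∩ C ≢ N v ∩ C

  IsOSet : Subset n → Set
  IsOSet C = ∀ u v → u ≢ v → N u ∩ C ≢ N v ∩ C

  IsISet : Subset n → Set
  IsISet C = ∀ u v → u ≢ v → N[ u ] ∩ C ≢ N[ v ] ∩ C

  IsFSet : Subset n → Set
  IsFSet C = IsOSet C × IsISet C

IsMinCard : {n : ℕ} → (Subset n → Set) → ℕ → Set
IsMinCard {n} S k = Σ (Subset n) (λ C → S C × ∣ C ∣ ≡ k) × (∀ C → S C → k ≤ ∣ C ∣)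

{-# OPTIONS --safe #-}
-- Every O-set and every I-set is an L-set (a vertex outside C has the same
-- trace on C through N(v) and N[v]), and an F-set is both an O-set and an
-- I-set; a minimum over a smaller class of sets is at least the minimum over
-- the larger one. Twin-freeness only ensures that γ^O, γ^I, γ^F exist.
module Submission where

open import Defs
open import Data.Nat using (ℕ; _≤_)
open import Data.Product using (_×_; _,_; proj₁; proj₂)
open import Data.Fin using (Fin)
open import Data.Fin.Subset using (Subset; _∩_; _∪_; ⁅_⁆; _∈_; _∉_; ⊥)
open import Data.Fin.Subset.Properties
  using (Empty-unique; x∈p∩q⁻; x∈⁅y⁆⇒x≡y; ∩-distribʳ-∪; ∪-identityʳ)
open import Relation.Nullary using (¬_)
open import Relation.Binary.PropositionalEquality
  using (_≡_; cong; subst; module ≡-Reasoning)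

module _ {n : ℕ} where

  ⁅x⁆∩p≡⊥ : {x : Fin n} {p : Subset n} → x ∉ p → ⁅ x ⁆ ∩ p ≡ ⊥
  ⁅x⁆∩p≡⊥ {x} {p} x∉p = Empty-unique λ (y , y∈⁅x⁆∩p) →
    let y∈⁅x⁆ , y∈p = x∈p∩q⁻ ⁅ x ⁆ p y∈⁅x⁆∩p
    in x∉p (subst (_∈ p) (x∈⁅y⁆⇒x≡y x y∈⁅x⁆) y∈p)

  [p∪⁅x⁆]∩q≡p∩q : (p : Subset n) {x : Fin n} {q : Subset n} →
                  x ∉ q → (p ∪ ⁅ x ⁆) ∩ q ≡ p ∩ q
  [p∪⁅x⁆]∩q≡p∩q p {x} {q} x∉q = begin
    (p ∪ ⁅ x ⁆) ∩ q        ≡⟨ ∩-distribʳ-∪ q p ⁅ x ⁆ ⟩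
    (p ∩ q) ∪ (⁅ x ⁆ ∩ q)  ≡⟨ cong ((p ∩ q) ∪_) (⁅x⁆∩p≡⊥ x∉q) ⟩
    (p ∩ q) ∪ ⊥            ≡⟨ ∪-identityʳ (p ∩ q) ⟩
    p ∩ q                  ∎
    where open ≡-Reasoning

  IsMinCard-antitone : {S T : Subset n → Set} {s t : ℕ} →
                       (∀ C → S C → T C) → IsMinCard T t → IsMinCard S s → t ≤ s
  IsMinCard-antitone S⇒T (_ , t≤) ((C , SC , ∣C∣≡s) , _) =
    subst (_ ≤_) ∣C∣≡s (t≤ C (S⇒T C SC))

module _ {n : ℕ} (G : Graph n) where

  N[x]∩C≡Nx∩C : {x : Fin n} {C : Subset n} → x ∉ C → N[ G ] x ∩ C ≡ N G x ∩ C
  N[x]∩C≡Nx∩C {x} = [p∪⁅x⁆]∩q≡p∩q (N G x)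

  IsOSet⇒IsLSet : ∀ C → IsOSet G C → IsLSet G C
  IsOSet⇒IsLSet C isO u v _ _ = isO u v

  IsISet⇒IsLSet : ∀ C → IsISet G C → IsLSet G C
  IsISet⇒IsLSet C isI u v u∉C v∉C u≢v Nu∩C≡Nv∩C = isI u v u≢v (begin
    N[ G ] u ∩ C  ≡⟨ N[x]∩C≡Nx∩C u∉C ⟩
    N G u ∩ C     ≡⟨ Nu∩C≡Nv∩C ⟩
    N G v ∩ C     ≡⟨ N[x]∩C≡Nx∩C v∉C ⟨
    N[ G ] v ∩ C  ∎)
    where open ≡-Reasoning

  IsFSet⇒IsOSet : ∀ C → IsFSet G C → IsOSet G C
  IsFSet⇒IsOSet _ = proj₁

  IsFSet⇒IsISet : ∀ C → IsFSet G C → IsISet G C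
  IsFSet⇒IsISet _ = proj₂

lemma4 : ∀ {n : ℕ} (G : Graph n) →
    (¬ HasOpenTwins G → ∀ l o → IsMinCard (IsLSet G) l → IsMinCard (IsOSet G) o → l ≤ o) ×
    (¬ HasClosedTwins G → ∀ l i → IsMinCard (IsLSet G) l → IsMinCard (IsISet G) i → l ≤ i) ×
    (¬ HasOpenTwins G → ¬ HasClosedTwins G →
      ∀ o i f → IsMinCard (IsOSet G) o → IsMinCard (IsISet G) i → IsMinCard (IsFSet G) f →
      o ≤ f × i ≤ f)
lemma4 G =
  (λ _ _ _ → IsMinCard-antitone (IsOSet⇒IsLSet G)) ,
  (λ _ _ _ → IsMinCard-antitone (IsISet⇒IsLSet G)) ,
  (λ _ _ _ _ _ γᴼ γᴵ γᶠ →
     IsMinCard-antitone (IsFSet⇒IsOSet G) γᴼ γᶠ ,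
     IsMinCard-antitone (IsFSet⇒IsISet G) γᴵ γᶠ)
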